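{- Let $T$ be a rooted binary tree with $n$ leaves containing a vertex $z$ whose two children are an internal vertex $a$ and a leaf $l$; let the children of $a$ be the roots of subtrees $T_1,T_2$, with $n_i$ the number of leaves of $T_i$ ($i=1,2$), $n_1\ge n_2$ and $n_1+n_2\ge 3$, and let $n_0$ be the number of leaves of $T$ not below $z$. Let $T'$ be the tree obtained from $T$ by making the children of $z$ the root of $T_1$ and a new vertex $b$ whose children are the root of $T_2$ and the leaf $l$ (the rest of $T$ unchanged). Then $c_5(T)\ge c_5(T')$. Furthermore, if $n\ge 7$, then $c_5(T)>c_5(T')$.
   Context: A rooted binary tree is a rooted tree in which every non-leaf vertex has exactly two unordered children. $Comb_5$ is the 5-leaf shape in which every non-leaf vertex has a leaf child. For a rooted binary tree $Q$ and a set $A$ of its leaves, $Q|_A$ is the restriction tree: vertices are the elements of $A$ and the lowest common ancestors of pairs of elements of $A$, with ancestry inherited from $Q$. For a rooted binary tree $T$, $c_5(T)$ is the number of 5-element subsets $A$ of the leaves of $T$ such that $T|_A$ has shape $Comb_5$. -}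

module Defs where

open import Data.Nat using (ℕ; zero; suc; _+_; _≡ᵇ_)
open import Data.Bool using (Bool; true; false; _∧_; _∨_; if_then_else_)
open import Data.Maybe using (Maybe; just; nothing)
open import Data.Vec using (Vec; []; _∷_; take; drop)
open import Data.List using (List; []; _∷_; map; _++_; filter; length)
open import Data.Fin.Subset using (Subset; ∣_∣)
open import Relation.Nullary.Decidable using (Dec; yes; no)
open import Relation.Binary.PropositionalEquality using (_≡_)
open import Data.Bool using (T)
open import Data.Bool.Properties using (T?)

-- A node has two children; the left/right order is
-- only a presentation (plane representative) of the unordered tree; all
-- quantities below are invariant under swapping children.
data Tree : Set where
  leaf : Tree
  node : Tree → Tree → Tree

leaves : Tree → ℕ
leaves leaf = 1
leaves (node l r) = leaves l + leaves r

isLeaf : Tree → Bool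
isLeaf leaf = true
isLeaf (node _ _) = false

isComb : Tree → Bool
isComb leaf = true
isComb (node l r) = (isLeaf l ∨ isLeaf r) ∧ (isComb l ∧ isComb r)

-- Restriction tree T|_A, A a set of leaves given as a subset of the leaves
-- (leaves numbered left to right). Its vertices are the elements of A and the
-- LCAs of pairs of elements of A, with inherited ancestry: computed by
-- suppressing vertices with at most one child whose subtree meets A.
-- (nothing = A empty)
combine : Maybe Tree → Maybe Tree → Maybe Tree
combine (just x) (just y) = just (node x y)
combine (just x) nothing = just x
combine nothing y = y

restrict : (t : Tree) → Subset (leaves t) → Maybe Tree
restrict leaf (b ∷ []) = if b then just leaf else nothing
restrict (node l r) v = combine (restrict l (take (leaves l) v)) (restrict r (drop (leaves l) v))

isComb5 : Maybe Tree → Bool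
isComb5 nothing = false
isComb5 (just t) = (leaves t ≡ᵇ 5) ∧ isComb t

allSubsets : (n : ℕ) → List (Subset n)
allSubsets zero = [] ∷ []
allSubsets (suc n) = map (true ∷_) (allSubsets n) ++ map (false ∷_) (allSubsets n)

good : (t : Tree) → Subset (leaves t) → Bool
good t A = (∣ A ∣ ≡ᵇ 5) ∧ isComb5 (restrict t A)

c5 : Tree → ℕ
c5 t = length (filter (λ A → T? (good t A)) (allSubsets (leaves t)))

-- one-hole contexts: the part of T outside the subtree rooted at z
data Ctx : Set where
  hole  : Ctx
  left  : Ctx → Tree → Ctx
  right : Tree → Ctx → Ctx

plug : Ctx → Tree → Tree
plug hole s = s
plug (left c r) s = node (plug c s) r
plug (right l c) s = node l (plug c s)

module Submission where

-- Let combCount t k be the number of k-sets of leaves of t inducing a comb. A comb with k leaves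
-- splits at its root into a comb and a single leaf (or nothing), so combCount (node l r) is a
-- product combCount l ⊛ combCount r of the two profiles, monotone in both factors. Rotating
-- (T₁ T₂) l into T₁ (T₂ l) loses exactly the combs made of a (k − 2)-comb of T₁, a leaf of T₂
-- and l: so combCount T′ ≤ combCount T in every degree, strictly in degree 4 since n₁ ≥ 2, and
-- in degree 5 once n₁ ≥ 3, which n ≥ 7 forces. Monotonicity of ⊛ carries this through the rest
-- of T, and any vertex above z turns the gain in degree 4 into one in degree 5.

open import Defs
open import Data.Nat using (ℕ; zero; suc; _+_; _*_; _≤_; _<_; _≥_; _≡ᵇ_; s≤s; z≤n; >-nonZero)
open import Data.Nat.Properties
open import Data.Nat.ListAction using (sum)
open import Data.Nat.ListAction.Properties using (sum-++)
open import Data.Nat.Tactic.RingSolver using (solve-∀)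
open import Algebra.Properties.CommutativeSemigroup +-commutativeSemigroup using (interchange)
open import Data.Bool using (Bool; true; false; _∧_; if_then_else_)
import Data.Bool as Bool
open import Data.Bool.Properties using (T?; ∧-zeroʳ; ∧-identityʳ; ∧-assoc; ∧-idem)
open import Data.Maybe using (Maybe; just; nothing; maybe)
open import Data.Vec using (Vec; []; _∷_; take; drop; _++_)
open import Data.Vec.Properties using (take++drop≡id; ++-injectiveˡ; ++-injectiveʳ)
open import Data.List using (List; []; _∷_; map; foldl; filter; length) renaming (_++_ to _++ᴸ_)
open import Data.List.Properties using (map-cong; map-++; map-∘)
open import Data.List.Membership.Propositional using (_∈_)
open import Data.List.Relation.Unary.Any using (here; there)
open import Data.Fin.Subset using (Subset; ∣_∣)
open import Data.Product using (_×_; _,_)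
open import Data.Empty using (⊥-elim)
open import Function using (_∘_)
open import Relation.Binary.PropositionalEquality

module _ {A : Set} where

  sum-map-+ : ∀ (f g : A → ℕ) xs → sum (map (λ x → f x + g x) xs) ≡ sum (map f xs) + sum (map g xs)
  sum-map-+ f g [] = refl
  sum-map-+ f g (x ∷ xs) =
    trans (cong (f x + g x +_) (sum-map-+ f g xs)) (interchange (f x) (g x) _ _)

  sum-map-*ˡ : ∀ c (f : A → ℕ) xs → sum (map (λ x → c * f x) xs) ≡ c * sum (map f xs)
  sum-map-*ˡ c f [] = sym (*-zeroʳ c)
  sum-map-*ˡ c f (x ∷ xs) =
    trans (cong (c * f x +_) (sum-map-*ˡ c f xs)) (sym (*-distribˡ-+ c (f x) _))

  sum-map-*ʳ : ∀ c (f : A → ℕ) xs → sum (map (λ x → f x * c) xs) ≡ sum (map f xs) * c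
  sum-map-*ʳ c f [] = refl
  sum-map-*ʳ c f (x ∷ xs) =
    trans (cong (f x * c +_) (sum-map-*ʳ c f xs)) (sym (*-distribʳ-+ c (f x) _))

  sum-map-zero : ∀ (xs : List A) → sum (map (λ _ → 0) xs) ≡ 0
  sum-map-zero [] = refl
  sum-map-zero (x ∷ xs) = sum-map-zero xs

  sum-map-∈ : ∀ (f : A → ℕ) {x xs} → x ∈ xs → f x ≤ sum (map f xs)
  sum-map-∈ f {xs = y ∷ ys} (here refl) = m≤m+n (f y) _
  sum-map-∈ f {xs = y ∷ ys} (there x∈ys) = ≤-trans (sum-map-∈ f x∈ys) (m≤n+m _ (f y))

  sum-map-mono : ∀ {f g : A → ℕ} → (∀ x → f x ≤ g x) → ∀ xs → sum (map f xs) ≤ sum (map g xs)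
  sum-map-mono f≤g [] = z≤n
  sum-map-mono f≤g (x ∷ xs) = +-mono-≤ (f≤g x) (sum-map-mono f≤g xs)

  sum-map-mono-< : ∀ {f g : A → ℕ} → (∀ x → f x ≤ g x) →
                   ∀ {x xs} → x ∈ xs → f x < g x → sum (map f xs) < sum (map g xs)
  sum-map-mono-< f≤g {xs = y ∷ ys} (here refl) fx<gx = +-mono-<-≤ fx<gx (sum-map-mono f≤g ys)
  sum-map-mono-< f≤g {xs = y ∷ ys} (there x∈ys) fx<gx = +-mono-≤-< (f≤g y) (sum-map-mono-< f≤g x∈ys fx<gx)

  length-filter-T? : ∀ (p : A → Bool) xs →
                     length (filter (T? ∘ p) xs) ≡ sum (map (λ x → if p x then 1 else 0) xs)
  length-filter-T? p [] = refl
  length-filter-T? p (x ∷ xs) with p x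
  ... | true  = cong suc (length-filter-T? p xs)
  ... | false = length-filter-T? p xs

foldl-+ : ∀ a xs → foldl _+_ a xs ≡ a + sum xs
foldl-+ a [] = sym (+-identityʳ a)
foldl-+ a (x ∷ xs) = trans (foldl-+ (a + x) xs) (+-assoc a x (sum xs))

sumSubsets : (n : ℕ) → (Subset n → ℕ) → ℕ
sumSubsets n f = sum (map f (allSubsets n))

sumSubsets-cong : ∀ n {f g : Subset n → ℕ} → (∀ A → f A ≡ g A) → sumSubsets n f ≡ sumSubsets n g
sumSubsets-cong n f≗g = cong sum (map-cong f≗g (allSubsets n))

sumSubsets-suc : ∀ n (f : Subset (suc n) → ℕ) →
                 sumSubsets (suc n) f ≡ sumSubsets n (f ∘ (true ∷_)) + sumSubsets n (f ∘ (false ∷_))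
sumSubsets-suc n f = begin
  sum (map f (map (true ∷_) As ++ᴸ map (false ∷_) As))
    ≡⟨ cong sum (map-++ f (map (true ∷_) As) (map (false ∷_) As)) ⟩
  sum (map f (map (true ∷_) As) ++ᴸ map f (map (false ∷_) As))
    ≡⟨ sum-++ (map f (map (true ∷_) As)) _ ⟩
  sum (map f (map (true ∷_) As)) + sum (map f (map (false ∷_) As))
    ≡⟨ sym (cong₂ _+_ (cong sum (map-∘ As)) (cong sum (map-∘ As))) ⟩
  sumSubsets n (f ∘ (true ∷_)) + sumSubsets n (f ∘ (false ∷_)) ∎
  where
  open ≡-Reasoning
  As = allSubsets n

sumSubsets-++ : ∀ m n (f : Subset (m + n) → ℕ) →
                sumSubsets (m + n) f ≡ sumSubsets m (λ u → sumSubsets n (λ w → f (u ++ w)))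
sumSubsets-++ zero n f = sym (+-identityʳ _)
sumSubsets-++ (suc m) n f = begin
  sumSubsets (suc m + n) f
    ≡⟨ sumSubsets-suc (m + n) f ⟩
  sumSubsets (m + n) (f ∘ (true ∷_)) + sumSubsets (m + n) (f ∘ (false ∷_))
    ≡⟨ cong₂ _+_ (sumSubsets-++ m n (f ∘ (true ∷_))) (sumSubsets-++ m n (f ∘ (false ∷_))) ⟩
  sumSubsets m (λ u → sumSubsets n (λ w → f (true ∷ u ++ w)))
    + sumSubsets m (λ u → sumSubsets n (λ w → f (false ∷ u ++ w)))
    ≡⟨ sumSubsets-suc m (λ u → sumSubsets n (λ w → f (u ++ w))) ⟨
  sumSubsets (suc m) (λ u → sumSubsets n (λ w → f (u ++ w))) ∎
  where open ≡-Reasoning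

sumSubsets-product : ∀ m n (f : Subset m → ℕ) (g : Subset n → ℕ) →
                     sumSubsets m (λ u → sumSubsets n (λ w → f u * g w)) ≡ sumSubsets m f * sumSubsets n g
sumSubsets-product m n f g = begin
  sumSubsets m (λ u → sumSubsets n (λ w → f u * g w))
    ≡⟨ sumSubsets-cong m (λ u → sum-map-*ˡ (f u) g (allSubsets n)) ⟩
  sumSubsets m (λ u → f u * sumSubsets n g)
    ≡⟨ sum-map-*ʳ (sumSubsets n g) f (allSubsets m) ⟩
  sumSubsets m f * sumSubsets n g ∎
  where open ≡-Reasoning

take-++ : ∀ {A : Set} m {n} (u : Vec A m) (w : Vec A n) → take m (u ++ w) ≡ u
take-++ m u w = ++-injectiveˡ (take m (u ++ w)) u (take++drop≡id m (u ++ w))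

drop-++ : ∀ {A : Set} m {n} (u : Vec A m) (w : Vec A n) → drop m (u ++ w) ≡ w
drop-++ m u w = ++-injectiveʳ (take m (u ++ w)) u (take++drop≡id m (u ++ w))

Profile : Set
Profile = ℕ → ℕ

_≤ₚ_ : Profile → Profile → Set
p ≤ₚ q = ∀ k → p k ≤ q k

-- A comb with k leaves splits at its root into combs with i and j leaves, i + j = k,
-- one of which has at most one leaf (0 for the empty side of a suppressed vertex).
splits : ℕ → List (ℕ × ℕ)
splits 0 = (0 , 0) ∷ []
splits 1 = (0 , 1) ∷ (1 , 0) ∷ []
splits 2 = (0 , 2) ∷ (1 , 1) ∷ (2 , 0) ∷ []
splits (suc (suc (suc j))) = (0 , 3 + j) ∷ (1 , 2 + j) ∷ (2 + j , 1) ∷ (3 + j , 0) ∷ []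

-- foldl, so that (p ⊛ q) k unfolds to p 0 * q k + p 1 * q (k ∸ 1) + … without a trailing + 0.
_⊛_ : Profile → Profile → Profile
(p ⊛ q) k = foldl _+_ 0 (map (λ (i , j) → p i * q j) (splits k))

⊛-sum : ∀ p q k → (p ⊛ q) k ≡ sum (map (λ (i , j) → p i * q j) (splits k))
⊛-sum p q k = foldl-+ 0 (map (λ (i , j) → p i * q j) (splits k))

⊛-cong : ∀ {p p′ q q′} → (∀ i → p i ≡ p′ i) → (∀ j → q j ≡ q′ j) →
         ∀ k → (p ⊛ q) k ≡ (p′ ⊛ q′) k
⊛-cong {p} {p′} {q} {q′} p≗p′ q≗q′ k = begin
  (p ⊛ q) k
    ≡⟨ ⊛-sum p q k ⟩
  sum (map (λ (i , j) → p i * q j) (splits k))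
    ≡⟨ cong sum (map-cong (λ (i , j) → cong₂ _*_ (p≗p′ i) (q≗q′ j)) (splits k)) ⟩
  sum (map (λ (i , j) → p′ i * q′ j) (splits k))
    ≡⟨ ⊛-sum p′ q′ k ⟨
  (p′ ⊛ q′) k ∎
  where open ≡-Reasoning

⊛-mono : ∀ {p p′ q q′} → p ≤ₚ p′ → q ≤ₚ q′ → (p ⊛ q) ≤ₚ (p′ ⊛ q′)
⊛-mono {p} {p′} {q} {q′} p≤p′ q≤q′ k = subst₂ _≤_ (sym (⊛-sum p q k)) (sym (⊛-sum p′ q′ k))
  (sum-map-mono (λ (i , j) → *-mono-≤ (p≤p′ i) (q≤q′ j)) (splits k))

⊛-term : ∀ p q k {i j} → (i , j) ∈ splits k → p i * q j ≤ (p ⊛ q) k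
⊛-term p q k ij∈ = subst (_ ≤_) (sym (⊛-sum p q k)) (sum-map-∈ (λ (i , j) → p i * q j) ij∈)

⊛-monoˡ-< : ∀ {p′ p} q k {i j} → p′ ≤ₚ p → (i , j) ∈ splits k → p′ i < p i → 1 ≤ q j →
            (p′ ⊛ q) k < (p ⊛ q) k
⊛-monoˡ-< {p′} {p} q k {j = j} p′≤p ij∈ p′i<pi 1≤qj =
  subst₂ _<_ (sym (⊛-sum p′ q k)) (sym (⊛-sum p q k))
    (sum-map-mono-< (λ (i , j) → *-monoˡ-≤ (q j) (p′≤p i)) ij∈
      (*-monoˡ-< (q j) {{>-nonZero 1≤qj}} p′i<pi))

⊛-monoʳ-< : ∀ p {q′ q} k {i j} → q′ ≤ₚ q → (i , j) ∈ splits k → q′ j < q j → 1 ≤ p i →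
            (p ⊛ q′) k < (p ⊛ q) k
⊛-monoʳ-< p {q′} {q} k {i} q′≤q ij∈ q′j<qj 1≤pi =
  subst₂ _<_ (sym (⊛-sum p q′ k)) (sym (⊛-sum p q k))
    (sum-map-mono-< (λ (i , j) → *-monoʳ-≤ (p i) (q′≤q j)) ij∈
      (*-monoʳ-< (p i) {{>-nonZero 1≤pi}} q′j<qj))

sumSubsets-⊛ : ∀ m n (F : Subset m → Profile) (G : Subset n → Profile) k →
               sumSubsets m (λ u → sumSubsets n (λ w → (F u ⊛ G w) k))
               ≡ ((λ i → sumSubsets m (λ u → F u i)) ⊛ (λ j → sumSubsets n (λ w → G w j))) k
sumSubsets-⊛ m n F G k = begin
  sumSubsets m (λ u → sumSubsets n (λ w → (F u ⊛ G w) k))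
    ≡⟨ sumSubsets-cong m (λ u → sumSubsets-cong n (λ w → ⊛-sum (F u) (G w) k)) ⟩
  sumSubsets m (λ u → sumSubsets n (λ w → sum (map (λ (i , j) → F u i * G w j) (splits k))))
    ≡⟨ bilinear (splits k) ⟩
  sum (map (λ (i , j) → ΣF i * ΣG j) (splits k))
    ≡⟨ ⊛-sum ΣF ΣG k ⟨
  (ΣF ⊛ ΣG) k ∎
  where
  open ≡-Reasoning
  ΣF ΣG : Profile
  ΣF i = sumSubsets m (λ u → F u i)
  ΣG j = sumSubsets n (λ w → G w j)

  bilinear : ∀ ps → sumSubsets m (λ u → sumSubsets n (λ w → sum (map (λ (i , j) → F u i * G w j) ps)))
                    ≡ sum (map (λ (i , j) → ΣF i * ΣG j) ps)
  bilinear [] = trans (sumSubsets-cong m (λ _ → sum-map-zero (allSubsets n))) (sum-map-zero (allSubsets m))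
  bilinear ((i , j) ∷ ps) = begin
    sumSubsets m (λ u → sumSubsets n (λ w → F u i * G w j + rest u w))
      ≡⟨ sumSubsets-cong m (λ u → sum-map-+ (λ w → F u i * G w j) (rest u) (allSubsets n)) ⟩
    sumSubsets m (λ u → sumSubsets n (λ w → F u i * G w j) + sumSubsets n (rest u))
      ≡⟨ sum-map-+ (λ u → sumSubsets n (λ w → F u i * G w j)) (λ u → sumSubsets n (rest u)) (allSubsets m) ⟩
    sumSubsets m (λ u → sumSubsets n (λ w → F u i * G w j)) + sumSubsets m (λ u → sumSubsets n (rest u))
      ≡⟨ cong₂ _+_ (sumSubsets-product m n (λ u → F u i) (λ w → G w j)) (bilinear ps) ⟩
    ΣF i * ΣG j + sum (map (λ (i , j) → ΣF i * ΣG j) ps) ∎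
    where
    rest : Subset m → Subset n → ℕ
    rest u w = sum (map (λ (i , j) → F u i * G w j) ps)

-- nothing, the restriction to the empty set, counts as the comb with 0 leaves.
isCombOf : ℕ → Maybe Tree → Bool
isCombOf k nothing  = k ≡ᵇ 0
isCombOf k (just t) = (leaves t ≡ᵇ k) ∧ isComb t

combIndicator : Maybe Tree → Profile
combIndicator x k = if isCombOf k x then 1 else 0

⊛-identityˡ : ∀ q k → (combIndicator nothing ⊛ q) k ≡ q k
⊛-identityˡ q 0 = *-identityˡ (q 0)
⊛-identityˡ q 1 = unit (q 1) (q 0) where
  unit : ∀ a b → 1 * a + 0 * b ≡ a
  unit = solve-∀
⊛-identityˡ q 2 = unit (q 2) (q 1) (q 0) where
  unit : ∀ a b c → 1 * a + 0 * b + 0 * c ≡ a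
  unit = solve-∀
⊛-identityˡ q (suc (suc (suc j))) = unit (q (3 + j)) (q (2 + j)) (q 1) (q 0) where
  unit : ∀ a b c d → 1 * a + 0 * b + 0 * c + 0 * d ≡ a
  unit = solve-∀

⊛-identityʳ : ∀ p k → (p ⊛ combIndicator nothing) k ≡ p k
⊛-identityʳ p 0 = *-identityʳ (p 0)
⊛-identityʳ p 1 = unit (p 0) (p 1) where
  unit : ∀ a b → a * 0 + b * 1 ≡ b
  unit = solve-∀
⊛-identityʳ p 2 = unit (p 0) (p 1) (p 2) where
  unit : ∀ a b c → a * 0 + b * 0 + c * 1 ≡ c
  unit = solve-∀
⊛-identityʳ p (suc (suc (suc j))) = unit (p 0) (p 1) (p (2 + j)) (p (3 + j)) where
  unit : ∀ a b c d → a * 0 + b * 0 + c * 0 + d * 1 ≡ d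
  unit = solve-∀

leafIndicator-⊛ : ∀ q k → (combIndicator (just leaf) ⊛ q) (suc k) ≡ q k
leafIndicator-⊛ q 0 = shift (q 1) (q 0) where
  shift : ∀ a b → 0 * a + 1 * b ≡ b
  shift = solve-∀
leafIndicator-⊛ q 1 = shift (q 2) (q 1) (q 0) where
  shift : ∀ a b c → 0 * a + 1 * b + 0 * c ≡ b
  shift = solve-∀
leafIndicator-⊛ q (suc (suc j)) = shift (q (3 + j)) (q (2 + j)) (q 1) (q 0) where
  shift : ∀ a b c d → 0 * a + 1 * b + 0 * c + 0 * d ≡ b
  shift = solve-∀

⊛-leafIndicator : ∀ p k → (p ⊛ combIndicator (just leaf)) (suc k) ≡ p k
⊛-leafIndicator p 0 = shift (p 0) (p 1) where
  shift : ∀ a b → a * 1 + b * 0 ≡ a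
  shift = solve-∀
⊛-leafIndicator p 1 = shift (p 0) (p 1) (p 2) where
  shift : ∀ a b c → a * 0 + b * 1 + c * 0 ≡ b
  shift = solve-∀
⊛-leafIndicator p (suc (suc j)) = shift (p 0) (p 1) (p (2 + j)) (p (3 + j)) where
  shift : ∀ a b c d → a * 0 + b * 0 + c * 1 + d * 0 ≡ c
  shift = solve-∀

⊛-vanish : ∀ {p q} → p 0 ≡ 0 → p 1 ≡ 0 → q 0 ≡ 0 → q 1 ≡ 0 → ∀ k → (p ⊛ q) k ≡ 0
⊛-vanish p₀ p₁ q₀ q₁ 0 rewrite p₀ = refl
⊛-vanish p₀ p₁ q₀ q₁ 1 rewrite p₀ | p₁ = refl
⊛-vanish {p} p₀ p₁ q₀ q₁ 2 rewrite p₀ | p₁ | q₀ = *-zeroʳ (p 2)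
⊛-vanish {p} p₀ p₁ q₀ q₁ (suc (suc (suc j)))
  rewrite p₀ | p₁ | q₀ | q₁ | *-zeroʳ (p (2 + j)) | *-zeroʳ (p (3 + j)) = refl

leaves-pos : ∀ t → 1 ≤ leaves t
leaves-pos leaf = s≤s z≤n
leaves-pos (node s t) = ≤-trans (leaves-pos s) (m≤m+n (leaves s) (leaves t))

leaves-node : ∀ s t → 2 ≤ leaves (node s t)
leaves-node s t = +-mono-≤ (leaves-pos s) (leaves-pos t)

combIndicator-≢ : ∀ t {k} → leaves t ≢ k → combIndicator (just t) k ≡ 0
combIndicator-≢ t {k} size≢k with leaves t ≡ᵇ k in eq
... | true  = ⊥-elim (size≢k (≡ᵇ⇒≡ (leaves t) k (subst Bool.T (sym eq) _)))
... | false = refl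

combIndicator-node : ∀ s t k →
  combIndicator (just (node s t)) k ≡ (combIndicator (just s) ⊛ combIndicator (just t)) k
combIndicator-node leaf t 0 = refl
combIndicator-node leaf t (suc k) = sym (leafIndicator-⊛ (combIndicator (just t)) k)
combIndicator-node s@(node a b) leaf k
  rewrite +-comm (leaves s) 1 | ∧-identityʳ (isComb s) with k
... | 0     = sym (*-zeroʳ (combIndicator (just s) 0))
... | suc k = sym (⊛-leafIndicator (combIndicator (just s)) k)
combIndicator-node s@(node a b) t@(node c d) k rewrite ∧-zeroʳ (leaves s + leaves t ≡ᵇ k) =
  sym (⊛-vanish {combIndicator (just s)} {combIndicator (just t)}
         (small a b z≤n) (small a b ≤-refl) (small c d z≤n) (small c d ≤-refl) k)
  where
  small : ∀ u v {i} → i ≤ 1 → combIndicator (just (node u v)) i ≡ 0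
  small u v i≤1 = combIndicator-≢ (node u v) λ size≡i →
    ≤⇒≯ i≤1 (subst (1 <_) size≡i (leaves-node u v))

combIndicator-combine : ∀ x y k → combIndicator (combine x y) k ≡ (combIndicator x ⊛ combIndicator y) k
combIndicator-combine nothing y k = sym (⊛-identityˡ (combIndicator y) k)
combIndicator-combine (just s) nothing k = sym (⊛-identityʳ (combIndicator (just s)) k)
combIndicator-combine (just s) (just t) k = combIndicator-node s t k

-- Defined by the recurrence, so that it computes on concrete shapes; combCount-correct shows that
-- combCount t k counts the k-sets of leaves of t inducing a comb.
combCount : Tree → Profile
combCount leaf k = combIndicator (just leaf) k + combIndicator nothing k
combCount (node l r) k = (combCount l ⊛ combCount r) k

combCount-correct : ∀ t k → sumSubsets (leaves t) (λ A → combIndicator (restrict t A) k) ≡ combCount t k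
combCount-correct leaf k = cong (combIndicator (just leaf) k +_) (+-identityʳ _)
combCount-correct (node l r) k = begin
  sumSubsets (m + n) (λ A → combIndicator (restrict (node l r) A) k)
    ≡⟨ sumSubsets-++ m n _ ⟩
  sumSubsets m (λ u → sumSubsets n (λ w → combIndicator (restrict (node l r) (u ++ w)) k))
    ≡⟨ sumSubsets-cong m (λ u → sumSubsets-cong n (λ w → split u w)) ⟩
  sumSubsets m (λ u → sumSubsets n (λ w → (combIndicator (restrict l u) ⊛ combIndicator (restrict r w)) k))
    ≡⟨ sumSubsets-⊛ m n (combIndicator ∘ restrict l) (combIndicator ∘ restrict r) k ⟩
  ((λ i → sumSubsets m (λ u → combIndicator (restrict l u) i))
     ⊛ (λ j → sumSubsets n (λ w → combIndicator (restrict r w) j))) k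
    ≡⟨ ⊛-cong (combCount-correct l) (combCount-correct r) k ⟩
  combCount (node l r) k ∎
  where
  open ≡-Reasoning
  m = leaves l
  n = leaves r
  split : ∀ u w → combIndicator (restrict (node l r) (u ++ w)) k
                  ≡ (combIndicator (restrict l u) ⊛ combIndicator (restrict r w)) k
  split u w = trans
    (cong₂ (λ u′ w′ → combIndicator (combine (restrict l u′) (restrict r w′)) k)
           (take-++ m u w) (drop-++ m u w))
    (combIndicator-combine (restrict l u) (restrict r w) k)

size : Maybe Tree → ℕ
size = maybe leaves 0

size-combine : ∀ x y → size (combine x y) ≡ size x + size y
size-combine (just s) (just t) = refl
size-combine (just s) nothing = sym (+-identityʳ (leaves s))
size-combine nothing y = refl

∣++∣ : ∀ {m n} (u : Subset m) (w : Subset n) → ∣ u ++ w ∣ ≡ ∣ u ∣ + ∣ w ∣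
∣++∣ [] w = refl
∣++∣ (true ∷ u) w = cong suc (∣++∣ u w)
∣++∣ (false ∷ u) w = ∣++∣ u w

size-restrict : ∀ t A → size (restrict t A) ≡ ∣ A ∣
size-restrict leaf (true ∷ []) = refl
size-restrict leaf (false ∷ []) = refl
size-restrict (node l r) A = begin
  size (combine (restrict l (take m A)) (restrict r (drop m A)))
    ≡⟨ size-combine (restrict l (take m A)) (restrict r (drop m A)) ⟩
  size (restrict l (take m A)) + size (restrict r (drop m A))
    ≡⟨ cong₂ _+_ (size-restrict l (take m A)) (size-restrict r (drop m A)) ⟩
  ∣ take m A ∣ + ∣ drop m A ∣
    ≡⟨ ∣++∣ (take m A) (drop m A) ⟨
  ∣ take m A ++ drop m A ∣
    ≡⟨ cong ∣_∣ (take++drop≡id m A) ⟩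
  ∣ A ∣ ∎
  where
  open ≡-Reasoning
  m = leaves l

good-isCombOf : ∀ t A → good t A ≡ isCombOf 5 (restrict t A)
good-isCombOf t A rewrite sym (size-restrict t A) = sized (restrict t A)
  where
  sized : ∀ x → (size x ≡ᵇ 5) ∧ isComb5 x ≡ isCombOf 5 x
  sized nothing = refl
  sized (just s) = trans (sym (∧-assoc (leaves s ≡ᵇ 5) _ _)) (cong (_∧ isComb s) (∧-idem _))

c5-combCount : ∀ t → c5 t ≡ combCount t 5
c5-combCount t = begin
  c5 t
    ≡⟨ length-filter-T? (good t) (allSubsets (leaves t)) ⟩
  sumSubsets (leaves t) (λ A → if good t A then 1 else 0)
    ≡⟨ sumSubsets-cong (leaves t) (λ A → cong (λ b → if b then 1 else 0) (good-isCombOf t A)) ⟩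
  sumSubsets (leaves t) (λ A → combIndicator (restrict t A) 5)
    ≡⟨ combCount-correct t 5 ⟩
  combCount t 5 ∎
  where open ≡-Reasoning

combCount-0 : ∀ t → combCount t 0 ≡ 1
combCount-0 leaf = refl
combCount-0 (node l r) rewrite combCount-0 l | combCount-0 r = refl

combCount-1 : ∀ t → combCount t 1 ≡ leaves t
combCount-1 leaf = refl
combCount-1 (node l r) rewrite combCount-0 l | combCount-0 r | combCount-1 l | combCount-1 r =
  trans (cong₂ _+_ (*-identityˡ (leaves r)) (*-identityʳ (leaves l))) (+-comm (leaves r) (leaves l))

combCount-1-pos : ∀ t → 1 ≤ combCount t 1
combCount-1-pos t = subst (1 ≤_) (sym (combCount-1 t)) (leaves-pos t)

combCount-2-pos : ∀ t → 2 ≤ leaves t → 1 ≤ combCount t 2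
combCount-2-pos leaf (s≤s ())
combCount-2-pos (node l r) _ = ≤-trans (*-mono-≤ (combCount-1-pos l) (combCount-1-pos r))
                                       (⊛-term (combCount l) (combCount r) 2 (there (here refl)))

combCount-3-pos : ∀ t → 3 ≤ leaves t → 1 ≤ combCount t 3
combCount-3-pos (node (node a b) r) _ =
  ≤-trans (*-mono-≤ (combCount-2-pos (node a b) (leaves-node a b)) (combCount-1-pos r))
          (⊛-term (combCount (node a b)) (combCount r) 3 (there (there (here refl))))
combCount-3-pos (node leaf (node c d)) _ =
  ≤-trans (*-mono-≤ (combCount-1-pos leaf) (combCount-2-pos (node c d) (leaves-node c d)))
          (⊛-term (combCount leaf) (combCount (node c d)) 3 (there (here refl)))
combCount-3-pos leaf (s≤s ())
combCount-3-pos (node leaf leaf) (s≤s (s≤s ()))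

addLeaf : Profile → Profile
addLeaf p 0 = p 0
addLeaf p (suc k) = p k + p (suc k)

⊛-combCount-leaf : ∀ p k → (p ⊛ combCount leaf) k ≡ addLeaf p k
⊛-combCount-leaf p 0 = *-identityʳ (p 0)
⊛-combCount-leaf p 1 = grow (p 0) (p 1) where
  grow : ∀ a b → a * 1 + b * 1 ≡ a + b
  grow = solve-∀
⊛-combCount-leaf p 2 = grow (p 0) (p 1) (p 2) where
  grow : ∀ a b c → a * 0 + b * 1 + c * 1 ≡ b + c
  grow = solve-∀
⊛-combCount-leaf p (suc (suc (suc j))) = grow (p 0) (p 1) (p (2 + j)) (p (3 + j)) where
  grow : ∀ a b c d → a * 0 + b * 0 + c * 1 + d * 1 ≡ c + d
  grow = solve-∀

-- The combs of T not in T′ consist of a (k ∸ 2)-leaf comb of T₁, one leaf of T₂ and l.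
rotationGain : Profile → Profile → Profile
rotationGain p q (suc (suc (suc (suc j)))) = p (2 + j) * q 1
rotationGain p q _ = 0

addLeaf-⊛ : ∀ p q k → addLeaf (p ⊛ q) k ≡ (p ⊛ addLeaf q) k + rotationGain p q k
addLeaf-⊛ p q 0 = sym (+-identityʳ _)
addLeaf-⊛ p q 1 = rotate (p 0) (p 1) (q 0) (q 1) where
  rotate : ∀ p₀ p₁ q₀ q₁ →
           p₀ * q₀ + (p₀ * q₁ + p₁ * q₀) ≡ p₀ * (q₀ + q₁) + p₁ * q₀ + 0
  rotate = solve-∀
addLeaf-⊛ p q 2 = rotate (p 0) (p 1) (p 2) (q 0) (q 1) (q 2) where
  rotate : ∀ p₀ p₁ p₂ q₀ q₁ q₂ →
           (p₀ * q₁ + p₁ * q₀) + (p₀ * q₂ + p₁ * q₁ + p₂ * q₀)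
           ≡ p₀ * (q₁ + q₂) + p₁ * (q₀ + q₁) + p₂ * q₀ + 0
  rotate = solve-∀
addLeaf-⊛ p q 3 = rotate (p 0) (p 1) (p 2) (p 3) (q 0) (q 1) (q 2) (q 3) where
  rotate : ∀ p₀ p₁ p₂ p₃ q₀ q₁ q₂ q₃ →
           (p₀ * q₂ + p₁ * q₁ + p₂ * q₀) + (p₀ * q₃ + p₁ * q₂ + p₂ * q₁ + p₃ * q₀)
           ≡ p₀ * (q₂ + q₃) + p₁ * (q₁ + q₂) + p₂ * (q₀ + q₁) + p₃ * q₀ + 0
  rotate = solve-∀
addLeaf-⊛ p q (suc (suc (suc (suc j)))) =
  rotate (p 0) (p 1) (p (2 + j)) (p (3 + j)) (p (4 + j)) (q 0) (q 1) (q (2 + j)) (q (3 + j)) (q (4 + j))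
  where
  rotate : ∀ p₀ p₁ p₂ p₃ p₄ q₀ q₁ q₂ q₃ q₄ →
           (p₀ * q₃ + p₁ * q₂ + p₂ * q₁ + p₃ * q₀) + (p₀ * q₄ + p₁ * q₃ + p₃ * q₁ + p₄ * q₀)
           ≡ p₀ * (q₃ + q₄) + p₁ * (q₂ + q₃) + p₃ * (q₀ + q₁) + p₄ * q₀ + p₂ * q₁
  rotate = solve-∀

combCount-rotate : ∀ T₁ T₂ k →
  combCount (node (node T₁ T₂) leaf) k
  ≡ combCount (node T₁ (node T₂ leaf)) k + rotationGain (combCount T₁) (combCount T₂) k
combCount-rotate T₁ T₂ k = begin
  ((p ⊛ q) ⊛ combCount leaf) k
    ≡⟨ ⊛-combCount-leaf (p ⊛ q) k ⟩
  addLeaf (p ⊛ q) k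
    ≡⟨ addLeaf-⊛ p q k ⟩
  (p ⊛ addLeaf q) k + rotationGain p q k
    ≡⟨ cong (_+ rotationGain p q k) (⊛-cong {p} {p} (λ _ → refl) (λ j → sym (⊛-combCount-leaf q j)) k) ⟩
  (p ⊛ (q ⊛ combCount leaf)) k + rotationGain p q k ∎
  where
  open ≡-Reasoning
  p = combCount T₁
  q = combCount T₂

_≼_ : Tree → Tree → Set
s′ ≼ s = combCount s′ ≤ₚ combCount s

rotate-≼ : ∀ T₁ T₂ → node T₁ (node T₂ leaf) ≼ node (node T₁ T₂) leaf
rotate-≼ T₁ T₂ k = subst (combCount (node T₁ (node T₂ leaf)) k ≤_) (sym (combCount-rotate T₁ T₂ k))
  (m≤m+n _ (rotationGain (combCount T₁) (combCount T₂) k))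

rotate-< : ∀ T₁ T₂ j → 1 ≤ combCount T₁ (2 + j) →
           combCount (node T₁ (node T₂ leaf)) (4 + j) < combCount (node (node T₁ T₂) leaf) (4 + j)
rotate-< T₁ T₂ j pos =
  subst (combCount (node T₁ (node T₂ leaf)) (4 + j) <_) (sym (combCount-rotate T₁ T₂ (4 + j)))
    (m<m+n _ (*-mono-≤ pos (combCount-1-pos T₂)))

plug-≼ : ∀ C {s′ s} → s′ ≼ s → plug C s′ ≼ plug C s
plug-≼ hole s′≼s = s′≼s
plug-≼ (left C r) s′≼s =
  ⊛-mono {q = combCount r} {q′ = combCount r} (plug-≼ C s′≼s) (λ _ → ≤-refl)
plug-≼ (right r C) s′≼s =
  ⊛-mono {p = combCount r} {p′ = combCount r} (λ _ → ≤-refl) (plug-≼ C s′≼s)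

plug-<₄ : ∀ C {s′ s} → s′ ≼ s → combCount s′ 4 < combCount s 4 →
          combCount (plug C s′) 4 < combCount (plug C s) 4
plug-<₄ hole s′≼s <₄ = <₄
plug-<₄ (left C r) s′≼s <₄ =
  ⊛-monoˡ-< (combCount r) 4 (plug-≼ C s′≼s) (there (there (there (here refl))))
    (plug-<₄ C s′≼s <₄) (≤-reflexive (sym (combCount-0 r)))
plug-<₄ (right r C) s′≼s <₄ =
  ⊛-monoʳ-< (combCount r) 4 (plug-≼ C s′≼s) (here refl)
    (plug-<₄ C s′≼s <₄) (≤-reflexive (sym (combCount-0 r)))

-- Only an empty context needs the gain in degree 5 itself; any node above converts a gain in degree 4.
plug-<₅ : ∀ C {s′ s} → s′ ≼ s → combCount s′ 4 < combCount s 4 →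
          (C ≡ hole → combCount s′ 5 < combCount s 5) →
          combCount (plug C s′) 5 < combCount (plug C s) 5
plug-<₅ hole s′≼s <₄ <₅ = <₅ refl
plug-<₅ (left C r) s′≼s <₄ _ =
  ⊛-monoˡ-< (combCount r) 5 (plug-≼ C s′≼s) (there (there (here refl)))
    (plug-<₄ C s′≼s <₄) (combCount-1-pos r)
plug-<₅ (right r C) s′≼s <₄ _ =
  ⊛-monoʳ-< (combCount r) 5 (plug-≼ C s′≼s) (there (here refl))
    (plug-<₄ C s′≼s <₄) (combCount-1-pos r)

k+k≤1+m+n⇒k≤m : ∀ {k m n} → n ≤ m → k + k ≤ suc (m + n) → k ≤ m
k+k≤1+m+n⇒k≤m {k} {m} {n} n≤m 2k≤ = ≮⇒≥ λ m<k → <-irrefl refl (begin-strict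
  suc (m + n)      <⟨ n<1+n (suc (m + n)) ⟩
  suc (suc (m + n)) ≡⟨ cong suc (+-suc m n) ⟨
  suc m + suc n    ≤⟨ +-mono-≤ m<k (≤-<-trans n≤m m<k) ⟩
  k + k            ≤⟨ 2k≤ ⟩
  suc (m + n)      ∎)
  where open ≤-Reasoning

lemma5p6 : (C : Ctx) (T₁ T₂ : Tree) →
    leaves T₁ ≥ leaves T₂ →
    3 ≤ leaves T₁ + leaves T₂ →
    (c5 (plug C (node T₁ (node T₂ leaf))) ≤ c5 (plug C (node (node T₁ T₂) leaf)))
    × (7 ≤ leaves (plug C (node (node T₁ T₂) leaf)) →
       c5 (plug C (node T₁ (node T₂ leaf))) < c5 (plug C (node (node T₁ T₂) leaf)))
lemma5p6 C T₁ T₂ n₂≤n₁ 3≤n₁+n₂ = c5-≤ , c5-<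
  where
  T T′ : Tree
  T = plug C (node (node T₁ T₂) leaf)
  T′ = plug C (node T₁ (node T₂ leaf))

  2≤n₁ : 2 ≤ leaves T₁
  2≤n₁ = k+k≤1+m+n⇒k≤m n₂≤n₁ (s≤s 3≤n₁+n₂)

  3≤n₁ : 7 ≤ leaves T₁ + leaves T₂ + 1 → 3 ≤ leaves T₁
  3≤n₁ 7≤n = k+k≤1+m+n⇒k≤m n₂≤n₁ (≤-trans (n≤1+n 6) (subst (7 ≤_) (+-comm _ 1) 7≤n))

  c5-≤ : c5 T′ ≤ c5 T
  c5-≤ = subst₂ _≤_ (sym (c5-combCount T′)) (sym (c5-combCount T)) (plug-≼ C (rotate-≼ T₁ T₂) 5)

  c5-< : 7 ≤ leaves T → c5 T′ < c5 T
  c5-< 7≤n = subst₂ _<_ (sym (c5-combCount T′)) (sym (c5-combCount T))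
    (plug-<₅ C (rotate-≼ T₁ T₂) (rotate-< T₁ T₂ 0 (combCount-2-pos T₁ 2≤n₁))
      λ { refl → rotate-< T₁ T₂ 1 (combCount-3-pos T₁ (3≤n₁ 7≤n)) })
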